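{- Let $x,y,z$ be distinct vertices in a graph $G$. Then $G$ has a $K_3$-minor rooted at $x,y,z$ if and only if every vertex of $G$ is good with respect to $x,y,z$.
   Context: All graphs are finite, simple and undirected. For distinct vertices $x,y,z$ of a graph $G$, a $K_3$-minor rooted at $x,y,z$ consists of three connected subgraphs $X,Y,Z$ of $G$ that are pairwise vertex-disjoint and pairwise adjacent (i.e. for each pair there is an edge of $G$ with one end in each), such that $x\in V(X)$, $y\in V(Y)$, $z\in V(Z)$. A vertex $v$ of $G$ is good (with respect to $x,y,z$) if at least two of $x,y,z$ lie in the same component of $G-v$; otherwise $v$ is bad. (If $v$ is one of $x,y,z$, then $v$ itself is deleted in $G-v$, and "at least two of $x,y,z$ in the same component of $G-v$" refers to the remaining ones.) -}

module Defs where

open import Data.Nat using (ℕ)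
open import Data.Fin using (Fin)
open import Data.Bool using (Bool; true; false)
open import Data.Product using (Σ; _×_; ∃)
open import Data.Sum using (_⊎_)
open import Data.Empty using (⊥)
open import Relation.Nullary using (¬_)
open import Relation.Binary.PropositionalEquality using (_≡_; _≢_)

record Graph : Set where
  field
    n      : ℕ
    adj    : Fin n → Fin n → Bool
    sym    : ∀ u v → adj u v ≡ adj v u
    irrefl : ∀ v → adj v v ≡ false

module _ (G : Graph) where
  open Graph G

  V : Set
  V = Fin n

  Edge : V → V → Set
  Edge u v = adj u v ≡ true

  data WalkIn (P : V → Set) : V → V → Set where
    here : ∀ {u} → P u → WalkIn P u u
    step : ∀ {u w v} → P u → Edge u w → WalkIn P w v → WalkIn P u v

  -- vertex subsets (branch sets); a connected subgraph is given by
  -- its vertex set, which must induce a connected subgraph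
  VSet : Set
  VSet = V → Bool

  _∈_ : V → VSet → Set
  v ∈ S = S v ≡ true

  Connected : VSet → Set
  Connected S = ∀ u v → u ∈ S → v ∈ S → WalkIn (λ w → w ∈ S) u v

  Disjoint : VSet → VSet → Set
  Disjoint S T = ∀ v → v ∈ S → v ∈ T → ⊥

  Touching : VSet → VSet → Set
  Touching S T = Σ V λ u → Σ V λ v → u ∈ S × v ∈ T × Edge u v

  RootedK3Minor : V → V → V → Set
  RootedK3Minor x y z =
    Σ VSet λ X → Σ VSet λ Y → Σ VSet λ Z →
      (x ∈ X × y ∈ Y × z ∈ Z)
      × (Connected X × Connected Y × Connected Z)
      × (Disjoint X Y × Disjoint X Z × Disjoint Y Z)
      × (Touching X Y × Touching X Z × Touching Y Z)

  SameComponentMinus : V → V → V → Set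
  SameComponentMinus v a b = a ≢ v × b ≢ v × WalkIn (λ w → w ≢ v) a b

  Good : V → V → V → V → Set
  Good x y z v =
    SameComponentMinus v x y ⊎ SameComponentMinus v x z ⊎ SameComponentMinus v y z

-- Necessity: a vertex v lies in at most one branch set, and the other two
-- branch sets are connected, adjacent and avoid v, so their roots are joined
-- in G - v.
--
-- Sufficiency: grow a connected set X ∋ x while keeping a y–z path P in G - X.
-- A neighbour of X off P is simply added to X.  Otherwise every neighbour of X
-- lies on P.  If there are two of them, cutting P between them gives the
-- branch sets of y and z.  If there is only one, p, then p separates X from
-- y and z; goodness of p yields a y–z walk avoiding p, hence avoiding X, and
-- p is added to X.  Each step enlarges X, so the process terminates.
module Submission where

open import Defs
open import Relation.Binary.PropositionalEquality using (_≢_)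
open import Data.Product using (_×_)
open import Function.Bundles using (_⇔_)

open import Data.Bool as Bool using (true)
open import Data.Empty using (⊥; ⊥-elim)
open import Data.Fin using (_≟_)
open import Data.Fin.Properties using (any?)
open import Data.Fin.Subset using (Subset; ⁅_⁆; _∪_; _⊂_; _⊃_)
  renaming (_∈_ to _∈ₛ_; _∉_ to _∉ₛ_)
open import Data.Fin.Subset.Induction using (⊃-wellFounded)
open import Data.Fin.Subset.Properties
  using (x∈⁅x⁆; x∈⁅y⁆⇒x≡y; x≢y⇒x∉⁅y⁆; p⊆p∪q; x∈p∪q⁺; x∈p∪q⁻)
  renaming (_∈?_ to _∈ₛ?_)
open import Data.List using (List; []; _∷_; _++_)
open import Data.List.Membership.Propositional.Properties using (∈-++⁺ˡ; ∈-++⁺ʳ)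
open import Data.List.Relation.Unary.All as All using (All; []; _∷_)
open import Data.List.Relation.Unary.All.Properties using (¬Any⇒All¬; ++⁻ʳ)
open import Data.List.Relation.Unary.Any as Any using (Any; here; there)
open import Data.List.Relation.Unary.AllPairs using ([]; _∷_)
open import Data.List.Relation.Unary.Unique.Propositional using (Unique)
open import Data.Product using (∃; ∃₂; _,_; proj₂)
open import Data.Sum using (_⊎_; inj₁; inj₂)
open import Data.Vec using (lookup)
open import Data.Vec.Properties using ([]=⇒lookup; lookup⇒[]=)
open import Function.Base using (_∘_)
open import Function.Bundles using (mk⇔)
open import Induction.WellFounded using (Acc; acc)
open import Relation.Binary.PropositionalEquality using (_≡_; refl; trans)
open import Relation.Nullary using (¬_; Dec; yes; no; does)
open import Relation.Nullary.Decidable using (_×-dec_; ¬?; dec-true)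
open import Relation.Unary using (Decidable)

private
  variable
    A : Set

does-true⇒ : (d : Dec A) → does d ≡ true → A
does-true⇒ (yes a) _ = a

x∉p⇒p⊂p∪⁅x⁆ : ∀ {n} {p : Subset n} {x} → x ∉ₛ p → p ⊂ p ∪ ⁅ x ⁆
x∉p⇒p⊂p∪⁅x⁆ {x = x} x∉p =
  p⊆p∪q ⁅ x ⁆ , x , x∈p∪q⁺ (inj₂ (x∈⁅x⁆ x)) , x∉p

module _ {A : Set} where
  open import Data.List.Membership.Propositional {A = A}
    using (lose) renaming (_∈_ to _∈ₗ_)

  Unique-++⇒disjoint : ∀ L {R} {a : A} → Unique (L ++ R) → a ∈ₗ L → a ∈ₗ R → ⊥
  Unique-++⇒disjoint (l ∷ L) (l∉ ∷ _) (here refl) a∈R =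
    All.lookup (++⁻ʳ L l∉) a∈R refl
  Unique-++⇒disjoint (l ∷ L) (_ ∷ uniq) (there a∈L) a∈R =
    Unique-++⇒disjoint L uniq a∈L a∈R

  SplitsBetween : (A → Set) → List A → Set
  SplitsBetween H ps = ∃₂ λ L R → ps ≡ L ++ R × Any H L × Any H R

  AtMostOne : (A → Set) → List A → Set
  AtMostOne H ps = ∀ {a b} → a ∈ₗ ps → b ∈ₗ ps → H a → H b → a ≡ b

  splitsBetween⊎atMostOne : ∀ {H} → Decidable H → ∀ ps →
    SplitsBetween H ps ⊎ AtMostOne H ps
  splitsBetween⊎atMostOne H? [] = inj₂ λ ()
  splitsBetween⊎atMostOne {H} H? (q ∷ qs) with H? q | Any.any? H? qs
  ... | yes hq | yes hqs = inj₁ (q ∷ [] , qs , refl , here hq , hqs)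
  ... | yes hq | no ¬hqs = inj₂ only-q
    where
      only-q : AtMostOne H (q ∷ qs)
      only-q (here refl) (here refl) _  _  = refl
      only-q _           (there b∈) _  hb = ⊥-elim (¬hqs (lose b∈ hb))
      only-q (there a∈)  _          ha _  = ⊥-elim (¬hqs (lose a∈ ha))
  ... | no ¬hq | _ with splitsBetween⊎atMostOne H? qs
  ...   | inj₁ (L , R , refl , hL , hR) = inj₁ (q ∷ L , R , refl , there hL , hR)
  ...   | inj₂ once = inj₂ once′
    where
      once′ : AtMostOne H (q ∷ qs)
      once′ (here refl) _           ha _  = ⊥-elim (¬hq ha)
      once′ _           (here refl) _  hb = ⊥-elim (¬hq hb)
      once′ (there a∈)  (there b∈)  ha hb = once a∈ b∈ ha hb

module _ (G : Graph) where
  open Graph G using (n; adj) renaming (sym to adj-sym)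
  open import Data.List.Membership.Propositional {A = V G}
    using (find) renaming (_∈_ to _∈ₗ_; _∉_ to _∉ₗ_)
  open import Data.List.Membership.DecPropositional {A = V G} _≟_
    using () renaming (_∈?_ to _∈ₗ?_)

  private
    variable
      P Q : V G → Set
      a b u v w : V G
      ps : List (V G)

  Edge-sym : Edge G u v → Edge G v u
  Edge-sym {u} {v} e = trans (adj-sym v u) e

  WalkIn-map : (∀ {w} → P w → Q w) → WalkIn G P a b → WalkIn G Q a b
  WalkIn-map f (here p)     = here (f p)
  WalkIn-map f (step p e W) = step (f p) e (WalkIn-map f W)

  WalkIn-head : WalkIn G P a b → P a
  WalkIn-head (here p)     = p
  WalkIn-head (step p _ _) = p

  WalkIn-last : WalkIn G P a b → P b
  WalkIn-last (here p)     = p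
  WalkIn-last (step _ _ W) = WalkIn-last W

  _▹_ : WalkIn G P a b → WalkIn G P b v → WalkIn G P a v
  here _     ▹ W′ = W′
  step p e W ▹ W′ = step p e (W ▹ W′)

  WalkIn-reverse : WalkIn G P a b → WalkIn G P b a
  WalkIn-reverse (here p)     = here p
  WalkIn-reverse (step p e W) =
    WalkIn-reverse W ▹ step (WalkIn-head W) (Edge-sym e) (here p)

  WalkIn-preserve : (∀ {u w} → P u → P w → Q u → Edge G u w → Q w) →
    WalkIn G P a b → Q a → WalkIn G (λ w → P w × Q w) a b
  WalkIn-preserve f (here p)     q = here (p , q)
  WalkIn-preserve f (step p e W) q =
    step (p , q) e (WalkIn-preserve f W (f p (WalkIn-head W) q e))

  Adjacent : Subset n → V G → Set
  Adjacent X v = ∃ λ u → u ∈ₛ X × Edge G u v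

  adjacent? : ∀ X → Decidable (Adjacent X)
  adjacent? X v = any? λ u → (u ∈ₛ? X) ×-dec (adj u v Bool.≟ true)

  WalkIn-exit : ∀ X → WalkIn G P a b → a ∈ₛ X → b ∉ₛ X →
    ∃ λ p → p ∉ₛ X × Adjacent X p
  WalkIn-exit X (here _) a∈X b∉X = ⊥-elim (b∉X a∈X)
  WalkIn-exit X (step {w = w} _ e W) a∈X b∉X with w ∈ₛ? X
  ... | yes w∈X = WalkIn-exit X W w∈X b∉X
  ... | no  w∉X = w , w∉X , _ , a∈X , e

  ConnectedIn : (V G → Set) → Set
  ConnectedIn P = ∀ {u v} → P u → P v → WalkIn G P u v

  ConnectedIn⇒Connected : (S : VSet G) → (∀ {v} → S v ≡ true → P v) →
    (∀ {v} → P v → S v ≡ true) → ConnectedIn P → Connected G S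
  ConnectedIn⇒Connected S to from conn u v u∈S v∈S =
    WalkIn-map from (conn (to u∈S) (to v∈S))

  ConnectedIn-⁅⁆ : ConnectedIn (_∈ₛ ⁅ v ⁆)
  ConnectedIn-⁅⁆ {v} u∈ w∈ with x∈⁅y⁆⇒x≡y v u∈ | x∈⁅y⁆⇒x≡y v w∈
  ... | refl | refl = here u∈

  ConnectedIn-attach : ∀ {X p} → ConnectedIn (_∈ₛ X) → Adjacent X p →
    ConnectedIn (_∈ₛ X ∪ ⁅ p ⁆)
  ConnectedIn-attach {X} {p} conn (r , r∈X , e) u∈ w∈ =
    to-r u∈ ▹ WalkIn-reverse (to-r w∈)
    where
      in-∪ : ∀ {w} → w ∈ₛ X → w ∈ₛ X ∪ ⁅ p ⁆
      in-∪ = x∈p∪q⁺ ∘ inj₁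

      to-r : ∀ {w} → w ∈ₛ X ∪ ⁅ p ⁆ → WalkIn G (_∈ₛ X ∪ ⁅ p ⁆) w r
      to-r {w} w∈ with x∈p∪q⁻ X ⁅ p ⁆ w∈
      ... | inj₁ w∈X = WalkIn-map in-∪ (conn w∈X r∈X)
      ... | inj₂ w∈p with x∈⁅y⁆⇒x≡y p w∈p
      ...   | refl = step w∈ (Edge-sym e) (here (in-∪ r∈X))

  data Path : V G → V G → List (V G) → Set where
    [_]  : ∀ u → Path u u (u ∷ [])
    _∷_  : Edge G u w → Path w v ps → Path u v (u ∷ ps)

  Path-first : Path u v ps → u ∈ₗ ps
  Path-first [ _ ]   = here refl
  Path-first (_ ∷ _) = here refl

  Path-last : Path u v ps → v ∈ₗ ps
  Path-last [ _ ]   = here refl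
  Path-last (_ ∷ π) = there (Path-last π)

  Path⇒WalkIn : Path u v ps → a ∈ₗ ps → WalkIn G (_∈ₗ ps) u a
  Path⇒WalkIn [ _ ]   (here refl) = here (here refl)
  Path⇒WalkIn (_ ∷ _) (here refl) = here (here refl)
  Path⇒WalkIn (e ∷ π) (there a∈)  =
    step (here refl) e (WalkIn-map there (Path⇒WalkIn π a∈))

  Path-connected : Path u v ps → ConnectedIn (_∈ₗ ps)
  Path-connected π a∈ b∈ =
    WalkIn-reverse (Path⇒WalkIn π a∈) ▹ Path⇒WalkIn π b∈

  Path-split : ∀ l L r R → Path u v ((l ∷ L) ++ (r ∷ R)) →
    ∃₂ λ a b → Path u a (l ∷ L) × Edge G a b × Path b v (r ∷ R)
  Path-split l []       r R (e ∷ π) = l , _ , [ l ] , e , π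
  Path-split l (m ∷ L)  r R (e ∷ π) with Path-split m L r R π
  ... | a , b , π₁ , e′ , π₂ = a , b , e ∷ π₁ , e′ , π₂

  fromList : List (V G) → VSet G
  fromList ps v = does (v ∈ₗ? ps)

  ∈-fromList⁺ : v ∈ₗ ps → fromList ps v ≡ true
  ∈-fromList⁺ {v} {ps} = dec-true (v ∈ₗ? ps)

  ∈-fromList⁻ : fromList ps v ≡ true → v ∈ₗ ps
  ∈-fromList⁻ {ps} {v} = does-true⇒ (v ∈ₗ? ps)

  record PathIn (P : V G → Set) (u v : V G) : Set where
    constructor pathIn
    field
      {vertices} : List (V G)
      path       : Path u v vertices
      unique     : Unique vertices
      inside     : All P vertices

  PathIn-suffix : (π : PathIn P a v) → u ∈ₗ PathIn.vertices π → PathIn P u v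
  PathIn-suffix (pathIn [ _ ] uniq ins)   (here refl) = pathIn [ _ ] uniq ins
  PathIn-suffix (pathIn (e ∷ π) uniq ins) (here refl) = pathIn (e ∷ π) uniq ins
  PathIn-suffix (pathIn (_ ∷ π) (_ ∷ uniq) (_ ∷ ins)) (there u∈) =
    PathIn-suffix (pathIn π uniq ins) u∈

  WalkIn⇒PathIn : WalkIn G P u v → PathIn P u v
  WalkIn⇒PathIn (here p) = pathIn [ _ ] ([] ∷ []) (p ∷ [])
  WalkIn⇒PathIn {u = u} (step p e W) with WalkIn⇒PathIn W
  ... | π@(pathIn {ps} path uniq ins) with u ∈ₗ? ps
  ...   | yes u∈ = PathIn-suffix π u∈
  ...   | no  u∉ = pathIn (e ∷ path) (¬Any⇒All¬ ps u∉ ∷ uniq) (p ∷ ins)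

  touching⇒sameComponentMinus : ∀ {S T} → Connected G S → Connected G T →
    Touching G S T → S a ≡ true → T b ≡ true → S v ≢ true → T v ≢ true →
    SameComponentMinus G v a b
  touching⇒sameComponentMinus {a} {b} {v} cS cT (s , t , s∈S , t∈T , e)
                              a∈S b∈T v∉S v∉T =
    avoid v∉S a∈S , avoid v∉T b∈T ,
    WalkIn-map (avoid v∉S) (cS a s a∈S s∈S) ▹
    step (avoid v∉S s∈S) e (WalkIn-map (avoid v∉T) (cT t b t∈T b∈T))
    where
      avoid : ∀ {S : VSet G} {w} → S v ≢ true → S w ≡ true → w ≢ v
      avoid v∉S w∈S refl = v∉S w∈S

  rootedK3Minor⇒good : ∀ {x y z} → RootedK3Minor G x y z → ∀ v → Good G x y z v
  rootedK3Minor⇒good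
    (X , Y , Z , (x∈X , y∈Y , z∈Z) , (cX , cY , cZ) , (dXY , dXZ , dYZ) , (tXY , tXZ , tYZ)) v
    with X v Bool.≟ true | Y v Bool.≟ true
  ... | yes v∈X | _ =
    inj₂ (inj₂ (touching⇒sameComponentMinus cY cZ tYZ y∈Y z∈Z (dXY v v∈X) (dXZ v v∈X)))
  ... | no v∉X | yes v∈Y =
    inj₂ (inj₁ (touching⇒sameComponentMinus cX cZ tXZ x∈X z∈Z v∉X (dYZ v v∈Y)))
  ... | no v∉X | no v∉Y =
    inj₁ (touching⇒sameComponentMinus cX cY tXY x∈X y∈Y v∉X v∉Y)

  module _ {x y z : V G} (good : ∀ v → Good G x y z v) where

    Route : Subset n → Set
    Route X = PathIn (_∉ₛ X) y z

    Route-y∉ : ∀ {X} → Route X → y ∉ₛ X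
    Route-y∉ (pathIn path _ outside) = All.lookup outside (Path-first path)

    Route-z∉ : ∀ {X} → Route X → z ∉ₛ X
    Route-z∉ (pathIn path _ outside) = All.lookup outside (Path-last path)

    Extension : Subset n → Set
    Extension X = ∃ λ p → p ∉ₛ X × Adjacent X p × Route (X ∪ ⁅ p ⁆)

    OffRoute : Subset n → List (V G) → Set
    OffRoute X ps = ∃ λ v → v ∉ₛ X × v ∉ₗ ps × Adjacent X v

    offRoute? : ∀ X ps → Dec (OffRoute X ps)
    offRoute? X ps = any? λ v → ¬? (v ∈ₛ? X) ×-dec ¬? (v ∈ₗ? ps) ×-dec adjacent? X v

    ∉-∪⁅⁆ : ∀ {X : Subset n} {p w} → w ∉ₛ X → w ≢ p → w ∉ₛ X ∪ ⁅ p ⁆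
    ∉-∪⁅⁆ {X} {p} w∉X w≢p w∈ with x∈p∪q⁻ X ⁅ p ⁆ w∈
    ... | inj₁ w∈X = w∉X w∈X
    ... | inj₂ w∈p = w≢p (x∈⁅y⁆⇒x≡y p w∈p)

    walk-avoiding-x : WalkIn G (_≢ x) y z
    walk-avoiding-x with good x
    ... | inj₁ (x≢x , _)        = ⊥-elim (x≢x refl)
    ... | inj₂ (inj₁ (x≢x , _)) = ⊥-elim (x≢x refl)
    ... | inj₂ (inj₂ (_ , _ , W)) = W

    walk-avoiding-z : WalkIn G (_≢ z) x y
    walk-avoiding-z with good z
    ... | inj₁ (_ , _ , W)                = W
    ... | inj₂ (inj₁ (_ , z≢z , _))       = ⊥-elim (z≢z refl)
    ... | inj₂ (inj₂ (_ , z≢z , _))       = ⊥-elim (z≢z refl)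

    extend-offRoute : ∀ {X} (r : Route X) → OffRoute X (PathIn.vertices r) → Extension X
    extend-offRoute (pathIn path uniq outside) (v , v∉X , v∉ps , adj-v) =
      v , v∉X , adj-v ,
      pathIn path uniq (All.tabulate λ w∈ →
        ∉-∪⁅⁆ (All.lookup outside w∈) λ { refl → v∉ps w∈ })

    extend-cutVertex : ∀ {X} → x ∈ₛ X → (r : Route X) →
      ¬ OffRoute X (PathIn.vertices r) → AtMostOne (Adjacent X) (PathIn.vertices r) →
      Extension X
    extend-cutVertex {X} x∈X r@(pathIn {ps} _ _ _) ¬off once
      with WalkIn-exit X walk-avoiding-z x∈X (Route-y∉ r)
    ... | p , p∉X , adj-p = p , p∉X , adj-p , route-avoiding-p
      where
        on-route : ∀ {v} → v ∉ₛ X → Adjacent X v → v ∈ₗ ps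
        on-route {v} v∉X adj-v with v ∈ₗ? ps
        ... | yes v∈ = v∈
        ... | no  v∉ = ⊥-elim (¬off (v , v∉X , v∉ , adj-v))

        only-p : ∀ {v} → v ∉ₛ X → Adjacent X v → v ≡ p
        only-p v∉X adj-v = once (on-route v∉X adj-v) (on-route p∉X adj-p) adj-v adj-p

        stays-in : ∀ {u w} → u ≢ p → w ≢ p → u ∈ₛ X → Edge G u w → w ∈ₛ X
        stays-in {w = w} _ w≢p u∈X e with w ∈ₛ? X
        ... | yes w∈X = w∈X
        ... | no  w∉X = ⊥-elim (w≢p (only-p w∉X (_ , u∈X , e)))

        stays-out : ∀ {u w} → u ≢ p → w ≢ p → u ∉ₛ X → Edge G u w → w ∉ₛ X
        stays-out u≢p _ u∉X e w∈X = u≢p (only-p u∉X (_ , w∈X , Edge-sym e))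

        route-avoiding-p : Route (X ∪ ⁅ p ⁆)
        route-avoiding-p with good p
        ... | inj₁ (_ , _ , W) =
          ⊥-elim (Route-y∉ r (proj₂ (WalkIn-last (WalkIn-preserve stays-in W x∈X))))
        ... | inj₂ (inj₁ (_ , _ , W)) =
          ⊥-elim (Route-z∉ r (proj₂ (WalkIn-last (WalkIn-preserve stays-in W x∈X))))
        ... | inj₂ (inj₂ (_ , _ , W)) =
          WalkIn⇒PathIn (WalkIn-map (λ (w≢p , w∉X) → ∉-∪⁅⁆ w∉X w≢p)
                                    (WalkIn-preserve stays-out W (Route-y∉ r)))

    split⇒rootedK3Minor : ∀ {X} → x ∈ₛ X → ConnectedIn (_∈ₛ X) → (r : Route X) →
      SplitsBetween (Adjacent X) (PathIn.vertices r) → RootedK3Minor G x y z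
    split⇒rootedK3Minor _ _ _ ([] , _ , _ , () , _)
    split⇒rootedK3Minor _ _ _ (_ ∷ _ , [] , _ , _ , ())
    split⇒rootedK3Minor {X} x∈X conn (pathIn path uniq outside)
                        (l ∷ L , r ∷ R , refl , adj-L , adj-R)
      with Path-split l L r R path
    ... | a , b , π₁ , e , π₂ =
      lookup X , fromList (l ∷ L) , fromList (r ∷ R) ,
      (∈⇒lookup x∈X , ∈-fromList⁺ (Path-first π₁) , ∈-fromList⁺ (Path-last π₂)) ,
      (ConnectedIn⇒Connected _ lookup⇒∈ ∈⇒lookup conn ,
       ConnectedIn⇒Connected _ ∈-fromList⁻ ∈-fromList⁺ (Path-connected π₁) ,
       ConnectedIn⇒Connected _ ∈-fromList⁻ ∈-fromList⁺ (Path-connected π₂)) ,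
      (disjoint-XY , disjoint-XZ , disjoint-YZ) ,
      (touching adj-L , touching adj-R ,
       (a , b , ∈-fromList⁺ (Path-last π₁) , ∈-fromList⁺ (Path-first π₂) , e))
      where
        ∈⇒lookup : ∀ {v} → v ∈ₛ X → lookup X v ≡ true
        ∈⇒lookup = []=⇒lookup

        lookup⇒∈ : ∀ {v} → lookup X v ≡ true → v ∈ₛ X
        lookup⇒∈ = lookup⇒[]= _ X

        disjoint-XY : Disjoint G (lookup X) (fromList (l ∷ L))
        disjoint-XY v v∈X v∈Y =
          All.lookup outside (∈-++⁺ˡ (∈-fromList⁻ {l ∷ L} v∈Y)) (lookup⇒∈ v∈X)

        disjoint-XZ : Disjoint G (lookup X) (fromList (r ∷ R))
        disjoint-XZ v v∈X v∈Z =
          All.lookup outside (∈-++⁺ʳ (l ∷ L) (∈-fromList⁻ v∈Z)) (lookup⇒∈ v∈X)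

        disjoint-YZ : Disjoint G (fromList (l ∷ L)) (fromList (r ∷ R))
        disjoint-YZ v v∈Y v∈Z =
          Unique-++⇒disjoint (l ∷ L) uniq (∈-fromList⁻ v∈Y) (∈-fromList⁻ v∈Z)

        touching : ∀ {M} → Any (Adjacent X) M → Touching G (lookup X) (fromList M)
        touching adj-M with find adj-M
        ... | v , v∈M , u , u∈X , e′ = u , v , ∈⇒lookup u∈X , ∈-fromList⁺ v∈M , e′

    minor⊎extension : ∀ {X} → x ∈ₛ X → ConnectedIn (_∈ₛ X) → Route X →
      RootedK3Minor G x y z ⊎ Extension X
    minor⊎extension {X} x∈X conn r with offRoute? X (PathIn.vertices r)
    ... | yes off = inj₂ (extend-offRoute r off)
    ... | no ¬off with splitsBetween⊎atMostOne (adjacent? X) (PathIn.vertices r)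
    ...   | inj₁ split = inj₁ (split⇒rootedK3Minor x∈X conn r split)
    ...   | inj₂ once  = inj₂ (extend-cutVertex x∈X r ¬off once)

    grow : ∀ {X} → Acc _⊃_ X → x ∈ₛ X → ConnectedIn (_∈ₛ X) → Route X →
      RootedK3Minor G x y z
    grow (acc larger) x∈X conn r with minor⊎extension x∈X conn r
    ... | inj₁ m = m
    ... | inj₂ (p , p∉X , adj-p , r′) =
      grow (larger (x∉p⇒p⊂p∪⁅x⁆ p∉X))
           (x∈p∪q⁺ (inj₁ x∈X)) (ConnectedIn-attach conn adj-p) r′

    good⇒rootedK3Minor : RootedK3Minor G x y z
    good⇒rootedK3Minor =
      grow (⊃-wellFounded ⁅ x ⁆) (x∈⁅x⁆ x) ConnectedIn-⁅⁆
           (WalkIn⇒PathIn (WalkIn-map x≢y⇒x∉⁅y⁆ walk-avoiding-x))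

lemma4 : (G : Graph) → (x y z : V G) → x ≢ y → x ≢ z → y ≢ z →
    RootedK3Minor G x y z ⇔ (∀ v → Good G x y z v)
lemma4 G x y z _ _ _ = mk⇔ (rootedK3Minor⇒good G) (good⇒rootedK3Minor G)
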